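{- If $\Xi\Longrightarrow\lceil\mathcal B\rceil(p)$ is a raw rule such that $p$ is a pattern and $\mathrm{mv}(p)=\mathrm{objmv}(\Xi)$, then the rule is deterministic.
   Context: Syntax of finitary type theories: expressions are built from free variables, bound variables, symbol applications $S(e_1,\dots,e_k)$ (respecting the arity of $S$) and metavariable applications $M(t_1,\ldots,t_n)$; arguments may also be dummies $\star$ (for equational arguments) or abstractions $\{x\}e$. A boundary thesis $\mathcal B$ is "$\Box$ type", "$\Box:A$", "$A\equiv B$ by $\Box$" or "$s\equiv t:A$ by $\Box$", and $\lceil\mathcal B\rceil(e)$ fills the hole with head $e$. A metavariable context $\Xi=[M_1:\mathcal{B}\!\!\mathcal{B}_1,\ldots,M_n:\mathcal{B}\!\!\mathcal{B}_n]$ assigns boundaries to metavariables; $M_i$ is an object metavariable if $\mathcal{B}\!\!\mathcal{B}_i$ is an object boundary (type or term, possibly abstracted), equational otherwise; $\mathrm{objmv}(\Xi)$ is the set of object metavariables and $\mathrm{mv}(e)$ the set of metavariables occurring in $e$. A raw rule $\Xi\Longrightarrow J$ is a judgement $\Xi;\emptyset\vdash J$. An instantiation $I=[M_1\mapsto e_1,\ldots,M_n\mapsto e_n]$ of $\Xi$ over a context $\Theta;\Gamma$ assigns to each $M_i$ an argument over $\Theta;\Gamma$ of the same arity (equational metavariables receive abstracted dummies), and acts on judgements by substitution $I_*$. A raw rule $\Xi\Longrightarrow J$ is deterministic if for every judgement $\Theta;\Gamma\vdash J'$ there exists at most one instantiation $I$ of $\Xi$ over $\Theta;\Gamma$ with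 $I_*J=J'$. Patterns: type patterns are $M()$ or $S(q_1,\dots,q_n)$; term patterns are $S(q_1,\dots,q_n)$; argument patterns are $\{\vec x\}M(\vec x)$ (where $\vec x$ are all the bound variables in scope), a type pattern, or a term pattern; in $S(q_1,\dots,q_n)$ one requires $\mathrm{mv}(q_i)\cap\mathrm{mv}(q_j)=\emptyset$ for $i\neq j$ (so each metavariable occurs at most once). -}

module Defs where

open import Data.Nat using (ℕ; zero; suc)
open import Data.Fin using (Fin; zero; suc; opposite)
open import Data.List using (List; []; _∷_; length; lookup)
open import Data.Product using (_×_; _,_; proj₁)
open import Data.Unit using (⊤)
open import Data.Empty using (⊥)
open import Relation.Binary.PropositionalEquality using (_≡_; _≢_)

data Class : Set where
  ty tm : Class

data EqClass : Set where
  eq-ty eq-tm : EqClass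

data Kind : Set where
  obj : Class → Kind
  eq  : EqClass → Kind

-- An arity of an argument / metavariable: kind and number of bound variables
MArity : Set
MArity = Kind × ℕ

IsObjKind : Kind → Set
IsObjKind (obj _) = ⊤
IsObjKind (eq _)  = ⊥

record Signature : Set₁ where
  field
    Symb  : Set
    cls   : Symb → Class
    arity : Symb → List MArity

-- Metavariable references: typed de Bruijn indices into a list of arities
-- (the head of the list is the most recently declared metavariable).
data MVar : List MArity → MArity → Set where
  here  : ∀ {a Ms} → MVar (a ∷ Ms) a
  there : ∀ {a b Ms} → MVar Ms a → MVar (b ∷ Ms) a

module Syntax (Sg : Signature) where
  open Signature Sg

  mutual
    data Expr (Ms : List MArity) (γ k : ℕ) : Class → Set where
      fvar : Fin γ → Expr Ms γ k tm
      bvar : Fin k → Expr Ms γ k tm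
      sym  : (S : Symb) → Args Ms γ k (arity S) → Expr Ms γ k (cls S)
      meta : ∀ {c n} → MVar Ms (obj c , n) → Terms Ms γ k n → Expr Ms γ k c

    data Terms (Ms : List MArity) (γ k : ℕ) : ℕ → Set where
      []  : Terms Ms γ k zero
      _∷_ : ∀ {n} → Expr Ms γ k tm → Terms Ms γ k n → Terms Ms γ k (suc n)

    data Arg (Ms : List MArity) (γ : ℕ) : ℕ → MArity → Set where
      ⟨_⟩ : ∀ {k c} → Expr Ms γ k c → Arg Ms γ k (obj c , zero)
      ⋆   : ∀ {k e} → Arg Ms γ k (eq e , zero)
      abs : ∀ {k κ n} → Arg Ms γ (suc k) (κ , n) → Arg Ms γ k (κ , suc n)

    data Args (Ms : List MArity) (γ k : ℕ) : List MArity → Set where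
      []  : Args Ms γ k []
      _∷_ : ∀ {a as} → Arg Ms γ k a → Args Ms γ k as → Args Ms γ k (a ∷ as)

  argAt : ∀ {Ms γ k as} → Args Ms γ k as → (i : Fin (length as)) → Arg Ms γ k (lookup as i)
  argAt (q ∷ qs) zero    = q
  argAt (q ∷ qs) (suc i) = argAt qs i

  tabulateTerms : ∀ {Ms γ k n} → (Fin n → Expr Ms γ k tm) → Terms Ms γ k n
  tabulateTerms {n = zero}  f = []
  tabulateTerms {n = suc n} f = f zero ∷ tabulateTerms (λ i → f (suc i))

  -- all bound variables in scope, outermost first:  x₁ , … , x_k
  boundVars : ∀ {Ms γ} k → Terms Ms γ k k
  boundVars k = tabulateTerms (λ i → bvar (opposite i))

  data Bdry (Ms : List MArity) (γ k : ℕ) : Kind → Set where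
    □type   : Bdry Ms γ k (obj ty)
    □∶_     : Expr Ms γ k ty → Bdry Ms γ k (obj tm)
    □eqty   : Expr Ms γ k ty → Expr Ms γ k ty → Bdry Ms γ k (eq eq-ty)
    □eqtm   : Expr Ms γ k tm → Expr Ms γ k tm → Expr Ms γ k ty
             → Bdry Ms γ k (eq eq-tm)

  data ABdry (Ms : List MArity) (k : ℕ) : MArity → Set where
    ⌊_⌋  : ∀ {κ} → Bdry Ms zero k κ → ABdry Ms k (κ , zero)
    abs  : ∀ {κ n} → Expr Ms zero k ty → ABdry Ms (suc k) (κ , n) → ABdry Ms k (κ , suc n)

  data MCtx : List MArity → Set where
    []  : MCtx []
    _▷_ : ∀ {Ms a} → MCtx Ms → ABdry Ms zero a → MCtx (a ∷ Ms)

  data VCtx (Ms : List MArity) : ℕ → Set where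
    []  : VCtx Ms zero
    _▷_ : ∀ {γ} → VCtx Ms γ → Expr Ms γ zero ty → VCtx Ms (suc γ)

  data Thesis (Ms : List MArity) (γ : ℕ) : Set where
    _type    : Expr Ms γ zero ty → Thesis Ms γ
    _∶_      : Expr Ms γ zero tm → Expr Ms γ zero ty → Thesis Ms γ
    _≡ty_    : Expr Ms γ zero ty → Expr Ms γ zero ty → Thesis Ms γ
    _≡tm_∶_  : Expr Ms γ zero tm → Expr Ms γ zero tm → Expr Ms γ zero ty → Thesis Ms γ

  -- ⌈𝓑⌉(e): filling the hole of a boundary with a head (expression or ⋆)
  fill : ∀ {Ms γ κ} → Bdry Ms γ zero κ → Arg Ms γ zero (κ , zero) → Thesis Ms γ
  fill □type        ⟨ A ⟩ = A type
  fill (□∶ A)       ⟨ t ⟩ = t ∶ A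
  fill (□eqty A B)  ⋆     = A ≡ty B
  fill (□eqtm s t A) ⋆  = s ≡tm t ∶ A

  liftR : ∀ {j k} → (Fin j → Fin k) → Fin (suc j) → Fin (suc k)
  liftR ρ zero    = zero
  liftR ρ (suc i) = suc (ρ i)

  mutual
    ren : ∀ {Ms γ j k c} → (Fin j → Fin k) → Expr Ms γ j c → Expr Ms γ k c
    ren ρ (fvar a)    = fvar a
    ren ρ (bvar i)    = bvar (ρ i)
    ren ρ (sym S es)  = sym S (renAs ρ es)
    ren ρ (meta M ts) = meta M (renTs ρ ts)

    renTs : ∀ {Ms γ j k n} → (Fin j → Fin k) → Terms Ms γ j n → Terms Ms γ k n
    renTs ρ []       = []
    renTs ρ (t ∷ ts) = ren ρ t ∷ renTs ρ ts

    renA : ∀ {Ms γ j k a} → (Fin j → Fin k) → Arg Ms γ j a → Arg Ms γ k a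
    renA ρ ⟨ e ⟩   = ⟨ ren ρ e ⟩
    renA ρ ⋆       = ⋆
    renA ρ (abs a) = abs (renA (liftR ρ) a)

    renAs : ∀ {Ms γ j k as} → (Fin j → Fin k) → Args Ms γ j as → Args Ms γ k as
    renAs ρ []       = []
    renAs ρ (a ∷ as) = renA ρ a ∷ renAs ρ as

  liftS : ∀ {Ms γ j k} → (Fin j → Expr Ms γ k tm) → Fin (suc j) → Expr Ms γ (suc k) tm
  liftS σ zero    = bvar zero
  liftS σ (suc i) = ren suc (σ i)

  mutual
    sub : ∀ {Ms γ j k c} → (Fin j → Expr Ms γ k tm) → Expr Ms γ j c → Expr Ms γ k c
    sub σ (fvar a)    = fvar a
    sub σ (bvar i)    = σ i
    sub σ (sym S es)  = sym S (subAs σ es)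
    sub σ (meta M ts) = meta M (subTs σ ts)

    subTs : ∀ {Ms γ j k n} → (Fin j → Expr Ms γ k tm) → Terms Ms γ j n → Terms Ms γ k n
    subTs σ []       = []
    subTs σ (t ∷ ts) = sub σ t ∷ subTs σ ts

    subA : ∀ {Ms γ j k a} → (Fin j → Expr Ms γ k tm) → Arg Ms γ j a → Arg Ms γ k a
    subA σ ⟨ e ⟩   = ⟨ sub σ e ⟩
    subA σ ⋆       = ⋆
    subA σ (abs a) = abs (subA (liftS σ) a)

    subAs : ∀ {Ms γ j k as} → (Fin j → Expr Ms γ k tm) → Args Ms γ j as → Args Ms γ k as
    subAs σ []       = []
    subAs σ (a ∷ as) = subA σ a ∷ subAs σ as

  _∷σ_ : ∀ {Ms γ j k} → Expr Ms γ k tm → (Fin j → Expr Ms γ k tm) → Fin (suc j) → Expr Ms γ k tm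
  (t ∷σ σ) zero    = t
  (t ∷σ σ) (suc i) = σ i

  -- application of an abstracted argument {x₁}…{xₙ}e to terms t₁,…,tₙ,
  -- i.e. e[t₁/x₁,…,tₙ/xₙ]  (σ accumulates the substitution)
  applyArg : ∀ {Ms γ j k c n} → Arg Ms γ j (obj c , n) → (Fin j → Expr Ms γ k tm)
           → Terms Ms γ k n → Expr Ms γ k c
  applyArg ⟨ e ⟩   σ []       = sub σ e
  applyArg (abs a) σ (t ∷ ts) = applyArg a (t ∷σ σ) ts

  data Inst (Θs : List MArity) (γ : ℕ) : List MArity → Set where
    []  : Inst Θs γ []
    _∷_ : ∀ {a Ms} → Arg Θs γ zero a → Inst Θs γ Ms → Inst Θs γ (a ∷ Ms)

  instLookup : ∀ {Θs γ Ms a} → Inst Θs γ Ms → MVar Ms a → Arg Θs γ zero a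
  instLookup (e ∷ I) here      = e
  instLookup (e ∷ I) (there x) = instLookup I x

  noVar : ∀ {Θs γ k} → Fin zero → Expr Θs γ k tm
  noVar ()

  mutual
    inst : ∀ {Ms Θs γ k c} → Inst Θs γ Ms → Expr Ms zero k c → Expr Θs γ k c
    inst I (fvar ())
    inst I (bvar i)    = bvar i
    inst I (sym S es)  = sym S (instAs I es)
    inst I (meta M ts) = applyArg (instLookup I M) noVar (instTs I ts)

    instTs : ∀ {Ms Θs γ k n} → Inst Θs γ Ms → Terms Ms zero k n → Terms Θs γ k n
    instTs I []       = []
    instTs I (t ∷ ts) = inst I t ∷ instTs I ts

    instA : ∀ {Ms Θs γ k a} → Inst Θs γ Ms → Arg Ms zero k a → Arg Θs γ k a
    instA I ⟨ e ⟩   = ⟨ inst I e ⟩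
    instA I ⋆       = ⋆
    instA I (abs a) = abs (instA I a)

    instAs : ∀ {Ms Θs γ k as} → Inst Θs γ Ms → Args Ms zero k as → Args Θs γ k as
    instAs I []       = []
    instAs I (a ∷ as) = instA I a ∷ instAs I as

  instThesis : ∀ {Ms Θs γ} → Inst Θs γ Ms → Thesis Ms zero → Thesis Θs γ
  instThesis I (A type)      = inst I A type
  instThesis I (t ∶ A)       = inst I t ∶ inst I A
  instThesis I (A ≡ty B)     = inst I A ≡ty inst I B
  instThesis I (s ≡tm t ∶ A) = inst I s ≡tm inst I t ∶ inst I A

  record RawRule : Set where
    constructor _⟹_
    field
      {mvs}  : List MArity
      ctx    : MCtx mvs
      thesis : Thesis mvs zero

  Deterministic : RawRule → Set
  Deterministic (_⟹_ {Ms} Ξ J) =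
    ∀ {Θs} (Θ : MCtx Θs) {γ} (Γ : VCtx Θs γ) (J' : Thesis Θs γ)
      (I I' : Inst Θs γ Ms) →
      instThesis I J ≡ J' → instThesis I' J ≡ J' → I ≡ I'

  mutual
    data Occ {Ms γ k} : ∀ {a c} → MVar Ms a → Expr Ms γ k c → Set where
      head   : ∀ {c n} {y : MVar Ms (obj c , n)} {ts} → Occ y (meta y ts)
      inMeta : ∀ {a c n} {x : MVar Ms a} {y : MVar Ms (obj c , n)} {ts}
             → OccTs x ts → Occ x (meta y ts)
      inSym  : ∀ {a S} {x : MVar Ms a} {es : Args Ms γ k (arity S)}
             → OccAs x es → Occ x (sym S es)

    data OccTs {Ms γ k} : ∀ {a n} → MVar Ms a → Terms Ms γ k n → Set where
      here  : ∀ {a n} {x : MVar Ms a} {t} {ts : Terms Ms γ k n} → Occ x t → OccTs x (t ∷ ts)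
      there : ∀ {a n} {x : MVar Ms a} {t} {ts : Terms Ms γ k n} → OccTs x ts → OccTs x (t ∷ ts)

    data OccA {Ms γ} : ∀ {k a b} → MVar Ms a → Arg Ms γ k b → Set where
      inExpr : ∀ {k a c} {x : MVar Ms a} {e : Expr Ms γ k c} → Occ x e → OccA x ⟨ e ⟩
      inAbs  : ∀ {k a b} {x : MVar Ms a} {q : Arg Ms γ (suc k) b} → OccA x q → OccA x (abs q)

    data OccAs {Ms γ k} : ∀ {a bs} → MVar Ms a → Args Ms γ k bs → Set where
      here  : ∀ {a b bs} {x : MVar Ms a} {q : Arg Ms γ k b} {qs : Args Ms γ k bs}
            → OccA x q → OccAs x (q ∷ qs)
      there : ∀ {a b bs} {x : MVar Ms a} {q : Arg Ms γ k b} {qs : Args Ms γ k bs}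
            → OccAs x qs → OccAs x (q ∷ qs)

  -- x ∈ objmv(Ξ): the boundary assigned to x in Ξ is an object boundary
  -- (the kind of the arity of x is the kind of its boundary in Ξ)
  ObjMV : ∀ {Ms a} → MCtx Ms → MVar Ms a → Set
  ObjMV {a = κ , n} Ξ x = IsObjKind κ

  DisjointMV : ∀ {Ms γ k as} → Args Ms γ k as → Set
  DisjointMV {Ms} {as = as} qs =
    (i j : Fin (length as)) → i ≢ j →
    ∀ {a} (x : MVar Ms a) → OccA x (argAt qs i) → OccA x (argAt qs j) → ⊥

  mutual
    data IsPattern {Ms γ k} : ∀ {c} → Expr Ms γ k c → Set where
      pmeta : (x : MVar Ms (obj ty , zero)) → IsPattern (meta x [])
      psym  : (S : Symb) {qs : Args Ms γ k (arity S)}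
            → ArgPatterns qs → DisjointMV qs → IsPattern (sym S qs)

    data IsArgPattern {Ms γ} : ∀ {k b} → Arg Ms γ k b → Set where
      pleaf : ∀ {k b} {q : Arg Ms γ k b} → IsAbsMeta q → IsArgPattern q
      pexpr : ∀ {k c} {e : Expr Ms γ k c} → IsPattern e → IsArgPattern ⟨ e ⟩

    data ArgPatterns {Ms γ k} : ∀ {bs} → Args Ms γ k bs → Set where
      []  : ArgPatterns []
      _∷_ : ∀ {b bs} {q : Arg Ms γ k b} {qs : Args Ms γ k bs}
          → IsArgPattern q → ArgPatterns qs → ArgPatterns (q ∷ qs)

    data IsAbsMeta {Ms γ} : ∀ {k b} → Arg Ms γ k b → Set where
      base : ∀ {k c} (x : MVar Ms (obj c , k)) → IsAbsMeta {k = k} ⟨ meta x (boundVars k) ⟩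
      abs  : ∀ {k b} {q : Arg Ms γ (suc k) b} → IsAbsMeta q → IsAbsMeta (abs q)

module Submission where

open import Defs
open import Data.Nat using (zero; suc)
open import Data.Fin using (Fin; zero; suc; opposite)
open import Data.Fin.Properties using (suc-injective; opposite-involutive)
open import Data.List using (List; _∷_)
open import Data.Product using (Σ; _×_; _,_; proj₁; proj₂)
open import Data.Unit using (tt)
open import Data.Empty using (⊥-elim)
open import Relation.Nullary using (¬_)
import Data.Vec.Functional as Vector
open import Function using (_∘_)
open import Function.Definitions using (Injective)
open import Relation.Binary.PropositionalEquality
  using (_≡_; _≢_; _≗_; refl; cong; cong₂; trans; module ≡-Reasoning)
  renaming (sym to ≡-sym)

-- Since Ξ ⟹ ⌈𝓑⌉(p) has an object head, I_* J determines I_* p. An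
-- equational metavariable can only be instantiated by abstracted ⋆, and every
-- object metavariable occurs in p, so it suffices that I_* p determines I(M)
-- for each M occurring in the pattern p. Going down the pattern, one reaches
-- a leaf {x⃗}M(x⃗), whose instance is I(M) applied to pairwise distinct bound
-- variables, i.e. the body of I(M) under an injective renaming; renamings
-- being injective on expressions, I(M) is recovered.

opposite-injective : ∀ {k} → Injective _≡_ _≡_ (opposite {k})
opposite-injective {_} {i} {j} h = begin
  i                      ≡⟨ opposite-involutive i ⟨
  opposite (opposite i)  ≡⟨ cong opposite h ⟩
  opposite (opposite j)  ≡⟨ opposite-involutive j ⟩
  j                      ∎
  where open ≡-Reasoning

module Determinism (Sg : Signature) where
  open Signature Sg
  open Syntax Sg

  terms-∷-injective : ∀ {Ms γ k n} {t t' : Expr Ms γ k tm} {ts ts' : Terms Ms γ k n}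
                    → _≡_ {A = Terms Ms γ k (suc n)} (t ∷ ts) (t' ∷ ts') → t ≡ t' × ts ≡ ts'
  terms-∷-injective refl = refl , refl

  args-∷-injective : ∀ {Ms γ k a as} {q q' : Arg Ms γ k a} {qs qs' : Args Ms γ k as}
                   → _≡_ {A = Args Ms γ k (a ∷ as)} (q ∷ qs) (q' ∷ qs') → q ≡ q' × qs ≡ qs'
  args-∷-injective refl = refl , refl

  ⟨⟩-injective : ∀ {Ms γ k c} {e e' : Expr Ms γ k c}
               → _≡_ {A = Arg Ms γ k (obj c , zero)} ⟨ e ⟩ ⟨ e' ⟩ → e ≡ e'
  ⟨⟩-injective refl = refl

  abs-injective : ∀ {Ms γ k κ n} {q q' : Arg Ms γ (suc k) (κ , n)}
                → _≡_ {A = Arg Ms γ k (κ , suc n)} (abs q) (abs q') → q ≡ q'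
  abs-injective refl = refl

  sym-injective : ∀ {Ms γ k S} {qs qs' : Args Ms γ k (arity S)} → sym S qs ≡ sym S qs' → qs ≡ qs'
  sym-injective refl = refl

  -- Equality of expressions whose classes are not known to agree; it is
  -- needed because the class of sym S qs is the non-constructor cls S.
  _≅_ : ∀ {Ms γ k c c'} → Expr Ms γ k c → Expr Ms γ k c' → Set
  _≅_ {Ms} {γ} {k} {c} {c'} e e' = _≡_ {A = Σ Class (Expr Ms γ k)} (c , e) (c' , e')

  bvar-≅-injective : ∀ {Ms γ k} {i i' : Fin k} → bvar {Ms} {γ} i ≅ bvar i' → i ≡ i'
  bvar-≅-injective refl = refl

  data SameSymbol {Ms γ k} : (S S' : Symb) → Args Ms γ k (arity S) → Args Ms γ k (arity S') → Set where
    same-symbol : ∀ {S qs qs'} → qs ≡ qs' → SameSymbol S S qs qs'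

  sym-≅-injective : ∀ {Ms γ k S S'} {qs : Args Ms γ k (arity S)} {qs' : Args Ms γ k (arity S')}
                  → sym S qs ≅ sym S' qs' → SameSymbol S S' qs qs'
  sym-≅-injective refl = same-symbol refl

  data SameMeta {Ms γ k} : ∀ {c c' n n'} → MVar Ms (obj c , n) → MVar Ms (obj c' , n')
                         → Terms Ms γ k n → Terms Ms γ k n' → Set where
    same-meta : ∀ {c n} {M : MVar Ms (obj c , n)} {ts ts'} → ts ≡ ts' → SameMeta M M ts ts'

  meta-≅-injective : ∀ {Ms γ k c c' n n'} {M : MVar Ms (obj c , n)} {M' : MVar Ms (obj c' , n')}
                       {ts : Terms Ms γ k n} {ts' : Terms Ms γ k n'}
                   → meta M ts ≅ meta M' ts' → SameMeta M M' ts ts'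
  meta-≅-injective refl = same-meta refl

  liftR-injective : ∀ {j k} {ρ : Fin j → Fin k} → Injective _≡_ _≡_ ρ → Injective _≡_ _≡_ (liftR ρ)
  liftR-injective ρ-inj {zero}  {zero}  h = refl
  liftR-injective ρ-inj {suc i} {suc j} h = cong suc (ρ-inj (suc-injective h))

  mutual
    ren-injective : ∀ {Ms γ j k c c'} {ρ : Fin j → Fin k} → Injective _≡_ _≡_ ρ
                  → (e : Expr Ms γ j c) (e' : Expr Ms γ j c') → ren ρ e ≅ ren ρ e' → e ≅ e'
    ren-injective ρ-inj (fvar a)    (fvar a)     refl = refl
    ren-injective ρ-inj (bvar i)    (bvar i')    h    = cong (λ x → tm , bvar x) (ρ-inj (bvar-≅-injective h))
    ren-injective ρ-inj (sym S qs)  (sym S' qs') h with sym-≅-injective h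
    ... | same-symbol h' = cong (λ x → cls S , sym S x) (renAs-injective ρ-inj qs qs' h')
    ren-injective ρ-inj (meta {c} M ts) (meta M' ts') h with meta-≅-injective h
    ... | same-meta h' = cong (λ x → c , meta M x) (renTs-injective ρ-inj ts ts' h')
    ren-injective ρ-inj (fvar _)   (bvar _)   ()
    ren-injective ρ-inj (fvar _)   (sym _ _)  ()
    ren-injective ρ-inj (fvar _)   (meta _ _) ()
    ren-injective ρ-inj (bvar _)   (fvar _)   ()
    ren-injective ρ-inj (bvar _)   (sym _ _)  ()
    ren-injective ρ-inj (bvar _)   (meta _ _) ()
    ren-injective ρ-inj (sym _ _)  (fvar _)   ()
    ren-injective ρ-inj (sym _ _)  (bvar _)   ()
    ren-injective ρ-inj (sym _ _)  (meta _ _) ()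
    ren-injective ρ-inj (meta _ _) (fvar _)   ()
    ren-injective ρ-inj (meta _ _) (bvar _)   ()
    ren-injective ρ-inj (meta _ _) (sym _ _)  ()

    renTs-injective : ∀ {Ms γ j k n} {ρ : Fin j → Fin k} → Injective _≡_ _≡_ ρ
                    → (ts ts' : Terms Ms γ j n) → renTs ρ ts ≡ renTs ρ ts' → ts ≡ ts'
    renTs-injective ρ-inj []       []         h = refl
    renTs-injective ρ-inj (t ∷ ts) (t' ∷ ts') h with terms-∷-injective h
    ... | h₁ , h₂ with ren-injective ρ-inj t t' (cong (tm ,_) h₁)
    ...   | refl = cong (t ∷_) (renTs-injective ρ-inj ts ts' h₂)

    renA-injective : ∀ {Ms γ j k a} {ρ : Fin j → Fin k} → Injective _≡_ _≡_ ρ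
                   → (q q' : Arg Ms γ j a) → renA ρ q ≡ renA ρ q' → q ≡ q'
    renA-injective ρ-inj (⟨_⟩ {c = c} e) ⟨ e' ⟩ h
      with ren-injective ρ-inj e e' (cong (c ,_) (⟨⟩-injective h))
    ... | refl = refl
    renA-injective ρ-inj ⋆       ⋆        h = refl
    renA-injective ρ-inj (abs q) (abs q') h =
      cong abs (renA-injective (liftR-injective ρ-inj) q q' (abs-injective h))

    renAs-injective : ∀ {Ms γ j k as} {ρ : Fin j → Fin k} → Injective _≡_ _≡_ ρ
                    → (qs qs' : Args Ms γ j as) → renAs ρ qs ≡ renAs ρ qs' → qs ≡ qs'
    renAs-injective ρ-inj []       []         h = refl
    renAs-injective ρ-inj (q ∷ qs) (q' ∷ qs') h with args-∷-injective h
    ... | h₁ , h₂ = cong₂ _∷_ (renA-injective ρ-inj q q' h₁) (renAs-injective ρ-inj qs qs' h₂)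

  liftS-renaming : ∀ {Ms γ j k} {σ : Fin j → Expr Ms γ k tm} {ρ : Fin j → Fin k}
                 → σ ≗ bvar ∘ ρ → liftS σ ≗ bvar ∘ liftR ρ
  liftS-renaming σ≗ρ zero    = refl
  liftS-renaming σ≗ρ (suc i) = cong (ren suc) (σ≗ρ i)

  mutual
    sub-renaming : ∀ {Ms γ j k c} {σ : Fin j → Expr Ms γ k tm} {ρ : Fin j → Fin k}
                 → σ ≗ bvar ∘ ρ → (e : Expr Ms γ j c) → sub σ e ≡ ren ρ e
    sub-renaming σ≗ρ (fvar a)    = refl
    sub-renaming σ≗ρ (bvar i)    = σ≗ρ i
    sub-renaming σ≗ρ (sym S qs)  = cong (sym S) (subAs-renaming σ≗ρ qs)
    sub-renaming σ≗ρ (meta M ts) = cong (meta M) (subTs-renaming σ≗ρ ts)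

    subTs-renaming : ∀ {Ms γ j k n} {σ : Fin j → Expr Ms γ k tm} {ρ : Fin j → Fin k}
                   → σ ≗ bvar ∘ ρ → (ts : Terms Ms γ j n) → subTs σ ts ≡ renTs ρ ts
    subTs-renaming σ≗ρ []       = refl
    subTs-renaming σ≗ρ (t ∷ ts) = cong₂ _∷_ (sub-renaming σ≗ρ t) (subTs-renaming σ≗ρ ts)

    subA-renaming : ∀ {Ms γ j k a} {σ : Fin j → Expr Ms γ k tm} {ρ : Fin j → Fin k}
                  → σ ≗ bvar ∘ ρ → (q : Arg Ms γ j a) → subA σ q ≡ renA ρ q
    subA-renaming σ≗ρ ⟨ e ⟩   = cong ⟨_⟩ (sub-renaming σ≗ρ e)
    subA-renaming σ≗ρ ⋆       = refl
    subA-renaming σ≗ρ (abs q) = cong abs (subA-renaming (liftS-renaming σ≗ρ) q)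

    subAs-renaming : ∀ {Ms γ j k as} {σ : Fin j → Expr Ms γ k tm} {ρ : Fin j → Fin k}
                   → σ ≗ bvar ∘ ρ → (qs : Args Ms γ j as) → subAs σ qs ≡ renAs ρ qs
    subAs-renaming σ≗ρ []       = refl
    subAs-renaming σ≗ρ (q ∷ qs) = cong₂ _∷_ (subA-renaming σ≗ρ q) (subAs-renaming σ≗ρ qs)

  sub-injective : ∀ {Ms γ j k c} {σ : Fin j → Expr Ms γ k tm} {ρ : Fin j → Fin k}
                → σ ≗ bvar ∘ ρ → Injective _≡_ _≡_ ρ
                → (e e' : Expr Ms γ j c) → sub σ e ≡ sub σ e' → e ≡ e'
  sub-injective {c = c} σ≗ρ ρ-inj e e' h
    with ren-injective ρ-inj e e'
           (cong (c ,_) (trans (≡-sym (sub-renaming σ≗ρ e)) (trans h (sub-renaming σ≗ρ e'))))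
  ... | refl = refl

  -- Applying an abstracted argument to distinct bound variables x_{f 0}, …,
  -- x_{f (n-1)} extends σ to an injective renaming, hence is injective.
  applyArg-injective : ∀ {Ms γ j k c n} {σ : Fin j → Expr Ms γ k tm} {ρ : Fin j → Fin k}
                       {f : Fin n → Fin k}
                     → σ ≗ bvar ∘ ρ → Injective _≡_ _≡_ ρ → Injective _≡_ _≡_ f
                     → (∀ i m → ρ i ≢ f m)
                     → (a a' : Arg Ms γ j (obj c , n))
                     → applyArg a σ (tabulateTerms (bvar ∘ f)) ≡ applyArg a' σ (tabulateTerms (bvar ∘ f))
                     → a ≡ a'
  applyArg-injective σ≗ρ ρ-inj f-inj ρ#f ⟨ e ⟩ ⟨ e' ⟩ h = cong ⟨_⟩ (sub-injective σ≗ρ ρ-inj e e' h)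
  applyArg-injective {j = j} {k} {σ = σ} {ρ} {f} σ≗ρ ρ-inj f-inj ρ#f (abs a) (abs a') h =
    cong abs (applyArg-injective σ'≗ρ' ρ'-inj (suc-injective ∘ f-inj) ρ'#f' a a' h)
    where
      ρ' : Fin (suc j) → Fin k
      ρ' = f zero Vector.∷ ρ

      σ'≗ρ' : (bvar (f zero) ∷σ σ) ≗ bvar ∘ ρ'
      σ'≗ρ' zero    = refl
      σ'≗ρ' (suc i) = σ≗ρ i

      ρ'-inj : Injective _≡_ _≡_ ρ'
      ρ'-inj {zero}  {zero}  q = refl
      ρ'-inj {zero}  {suc i} q = ⊥-elim (ρ#f i zero (≡-sym q))
      ρ'-inj {suc i} {zero}  q = ⊥-elim (ρ#f i zero q)
      ρ'-inj {suc i} {suc j} q = cong suc (ρ-inj q)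

      ρ'#f' : ∀ i m → ρ' i ≢ f (suc m)
      ρ'#f' zero    m q with f-inj q
      ... | ()
      ρ'#f' (suc i) m q = ρ#f i (suc m) q

  instTs-bvars : ∀ {Ms Θs γ k n} (I : Inst Θs γ Ms) (f : Fin n → Fin k)
               → instTs I (tabulateTerms (bvar ∘ f)) ≡ tabulateTerms (bvar ∘ f)
  instTs-bvars {n = zero}  I f = refl
  instTs-bvars {n = suc n} I f = cong (bvar (f zero) ∷_) (instTs-bvars I (f ∘ suc))

  ¬OccTs-bvars : ∀ {Ms k n a} {x : MVar Ms a} (f : Fin n → Fin k)
               → ¬ OccTs {γ = zero} x (tabulateTerms (bvar ∘ f))
  ¬OccTs-bvars {n = suc n} f (there o) = ¬OccTs-bvars (f ∘ suc) o

  module _ {Ms Θs γ} (I I' : Inst Θs γ Ms) where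

    meta-bvars-determines : ∀ {k n c} (y : MVar Ms (obj c , n)) {f : Fin n → Fin k}
                          → Injective _≡_ _≡_ f
                          → inst I (meta y (tabulateTerms (bvar ∘ f))) ≡ inst I' (meta y (tabulateTerms (bvar ∘ f)))
                          → instLookup I y ≡ instLookup I' y
    meta-bvars-determines {k} {n} y {f} f-inj h =
      applyArg-injective {ρ = λ ()} (λ ()) (λ { {()} }) f-inj (λ ()) (instLookup I y) (instLookup I' y) (begin
        applyArg (instLookup I y) noVar bvars              ≡⟨ cong (applyArg (instLookup I y) noVar) (instTs-bvars I f) ⟨
        applyArg (instLookup I y) noVar (instTs I bvars)   ≡⟨ h ⟩
        applyArg (instLookup I' y) noVar (instTs I' bvars) ≡⟨ cong (applyArg (instLookup I' y) noVar) (instTs-bvars I' f) ⟩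
        applyArg (instLookup I' y) noVar bvars             ∎)
      where
        open ≡-Reasoning
        bvars : ∀ {Ns δ} → Terms Ns δ k n
        bvars = tabulateTerms (bvar ∘ f)

    absMeta-determines : ∀ {k b a} {q : Arg Ms zero k b} {x : MVar Ms a}
                       → IsAbsMeta q → instA I q ≡ instA I' q → OccA x q
                       → instLookup I x ≡ instLookup I' x
    absMeta-determines (base y) h (inExpr head)       = meta-bvars-determines y opposite-injective (⟨⟩-injective h)
    absMeta-determines (base y) h (inExpr (inMeta o)) = ⊥-elim (¬OccTs-bvars opposite o)
    absMeta-determines (abs m)  h (inAbs o)           = absMeta-determines m (abs-injective h) o

    mutual
      pattern-determines : ∀ {k c a} {e : Expr Ms zero k c} {x : MVar Ms a}
                         → IsPattern e → inst I e ≡ inst I' e → Occ x e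
                         → instLookup I x ≡ instLookup I' x
      pattern-determines (pmeta y)     h head      = meta-bvars-determines y {λ ()} (λ { {()} }) h
      pattern-determines (psym S qs _) h (inSym o) = argPatterns-determine qs (sym-injective h) o

      argPatterns-determine : ∀ {k bs a} {qs : Args Ms zero k bs} {x : MVar Ms a}
                            → ArgPatterns qs → instAs I qs ≡ instAs I' qs → OccAs x qs
                            → instLookup I x ≡ instLookup I' x
      argPatterns-determine (q ∷ qs) h (here o)  = argPattern-determines q (proj₁ (args-∷-injective h)) o
      argPatterns-determine (q ∷ qs) h (there o) = argPatterns-determine qs (proj₂ (args-∷-injective h)) o

      argPattern-determines : ∀ {k b a} {q : Arg Ms zero k b} {x : MVar Ms a}
                            → IsArgPattern q → instA I q ≡ instA I' q → OccA x q
                            → instLookup I x ≡ instLookup I' x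
      argPattern-determines (pleaf m) h o          = absMeta-determines m h o
      argPattern-determines (pexpr e) h (inExpr o) = pattern-determines e (⟨⟩-injective h) o

  equational-args-equal : ∀ {Θs γ j e n} (q q' : Arg Θs γ j (eq e , n)) → q ≡ q'
  equational-args-equal ⋆       ⋆        = refl
  equational-args-equal (abs q) (abs q') = cong abs (equational-args-equal q q')

  inst-extensionality : ∀ {Θs γ Ms} (I I' : Inst Θs γ Ms)
                      → (∀ {a} (x : MVar Ms a) → instLookup I x ≡ instLookup I' x) → I ≡ I'
  inst-extensionality []      []        agree = refl
  inst-extensionality (q ∷ I) (q' ∷ I') agree =
    cong₂ _∷_ (agree here) (inst-extensionality I I' (agree ∘ there))

  type-injective : ∀ {Θs γ} {A B : Expr Θs γ zero ty} → (A type) ≡ (B type) → A ≡ B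
  type-injective refl = refl

  ∶-injectiveˡ : ∀ {Θs γ} {t u : Expr Θs γ zero tm} {A B} → (t ∶ A) ≡ (u ∶ B) → t ≡ u
  ∶-injectiveˡ refl = refl

  instThesis-fill-injective : ∀ {Ms Θs γ c} (𝓑 : Bdry Ms zero zero (obj c)) (e : Expr Ms zero zero c)
                              {I I' : Inst Θs γ Ms}
                            → instThesis I (fill 𝓑 ⟨ e ⟩) ≡ instThesis I' (fill 𝓑 ⟨ e ⟩)
                            → inst I e ≡ inst I' e
  instThesis-fill-injective □type  e = type-injective
  instThesis-fill-injective (□∶ A) e = ∶-injectiveˡ

proposition3p6 :
    (Sg : Signature) → let open Syntax Sg in
    ∀ {Ms : List MArity} (Ξ : MCtx Ms) {c : Class}
      (𝓑 : Bdry Ms zero zero (obj c)) (p : Expr Ms zero zero c) →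
    IsPattern p →
    (∀ {a} (x : MVar Ms a) → (Occ x p → ObjMV Ξ x) × (ObjMV Ξ x → Occ x p)) →
    Deterministic (Ξ ⟹ fill 𝓑 ⟨ p ⟩)
proposition3p6 Sg {Ms} Ξ 𝓑 p p-pattern mv-p≡objmv-Ξ _ _ _ I I' I*J≡J' I'*J≡J' =
  inst-extensionality I I' agree
  where
    open Syntax Sg
    open Determinism Sg

    I*p≡I'*p : inst I p ≡ inst I' p
    I*p≡I'*p = instThesis-fill-injective 𝓑 p (trans I*J≡J' (≡-sym I'*J≡J'))

    agree : ∀ {a} (x : MVar Ms a) → instLookup I x ≡ instLookup I' x
    agree {obj _ , _} x = pattern-determines I I' p-pattern I*p≡I'*p (proj₂ (mv-p≡objmv-Ξ x) tt)
    agree {eq _ , _}  x = equational-args-equal _ _
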